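{- Let $T$ be a tree with $|V(T)|\geq 3$ and let $u$ be a vertex of $T$. Suppose that $u$ is not a support vertex of $T$ and that $u$ has at most one neighbor in $T$ which is not a support vertex of $T$. Let $G_1$ be the graph obtained from $T$ by attaching a new leaf vertex $v$ at $u$. Then (i) $D_{G_1}(1)\leq D_T(1)+3D_{T\setminus u}(1)$; (ii) $D_{G_1}(1)\leq 5D_{T\setminus u}(1)$; (iii) $D_T(1)\leq 3D_{T\setminus u}(1)$.
   Context: All graphs are finite, simple and undirected. A set $S\subseteq V(G)$ is a dominating set of $G$ if every vertex of $V(G)\setminus S$ is adjacent to some vertex of $S$. For a graph $G$, $D_G(x)=\sum_{S}x^{|S|}$ is the domination polynomial (sum over all dominating sets $S$ of $G$), so $D_G(1)$ is the number of dominating sets of $G$. $T\setminus u$ is the subgraph induced by $V(T)\setminus\{u\}$. A leaf is a vertex of degree one; a support vertex is a vertex adjacent to a leaf. -}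

module Defs where

open import Data.Nat using (ℕ; zero; suc; _+_; _*_; _≤_)
open import Data.Bool using (Bool; true; false; _∧_; _∨_; if_then_else_)
open import Data.Fin using (Fin; zero; suc; punchIn; _≟_)
open import Data.Vec using (Vec; []; _∷_; lookup)
open import Data.List using (List; []; _∷_; map; _++_; allFin; length; filterᵇ)
open import Data.Bool.ListAction using (any; all)
open import Data.Product using (Σ; _×_; ∃; _,_)
open import Relation.Binary.PropositionalEquality using (_≡_; _≢_)
open import Relation.Nullary using (¬_; does)

record Graph (n : ℕ) : Set where
  field
    adj   : Fin n → Fin n → Bool
    sym   : ∀ i j → adj i j ≡ adj j i
    irrefl : ∀ i → adj i i ≡ false
open Graph public

Adj : ∀ {n} → Graph n → Fin n → Fin n → Set
Adj G i j = adj G i j ≡ true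

degree : ∀ {n} → Graph n → Fin n → ℕ
degree {n} G i = length (filterᵇ (adj G i) (allFin n))

IsLeaf : ∀ {n} → Graph n → Fin n → Set
IsLeaf G v = degree G v ≡ 1

IsSupport : ∀ {n} → Graph n → Fin n → Set
IsSupport G u = ∃ λ w → Adj G u w × IsLeaf G w

data Walk {n} (G : Graph n) : Fin n → Fin n → Set where
  here  : ∀ v → Walk G v v
  step  : ∀ {u v w} → Adj G u v → Walk G v w → Walk G u w

Connected : ∀ {n} → Graph n → Set
Connected {n} G = ∀ (x y : Fin n) → Walk G x y

IsPathList : ∀ {n} → Graph n → List (Fin n) → Set
IsPathList G []           = Data.Unit.⊤
  where import Data.Unit
IsPathList G (x ∷ [])     = Data.Unit.⊤
  where import Data.Unit
IsPathList G (x ∷ y ∷ xs) = Adj G x y × IsPathList G (y ∷ xs)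

open import Data.List.Relation.Unary.Unique.Propositional using (Unique)
open import Data.List using (head; last)
open import Data.Maybe using (just)

HasCycle : ∀ {n} → Graph n → Set
HasCycle {n} G =
  Σ (Fin n) λ a → Σ (Fin n) λ b → Σ (Fin n) λ c → Σ (List (Fin n)) λ rest →
    let vs = a ∷ b ∷ c ∷ rest in
    Unique vs × IsPathList G vs × Σ (Fin n) λ z → (last vs ≡ just z) × Adj G z a

IsTree : ∀ {n} → Graph n → Set
IsTree G = Connected G × ¬ HasCycle G

deleteVertex : ∀ {n} → Graph (suc n) → Fin (suc n) → Graph n
deleteVertex G u = record
  { adj    = λ i j → adj G (punchIn u i) (punchIn u j)
  ; sym    = λ i j → sym G (punchIn u i) (punchIn u j)
  ; irrefl = λ i → irrefl G (punchIn u i)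
  }

-- attach a new leaf (vertex zero) at u; old vertex i becomes suc i
attachAdj : ∀ {n} → Graph n → Fin n → Fin (suc n) → Fin (suc n) → Bool
attachAdj G u zero    zero    = false
attachAdj G u zero    (suc j) = does (j ≟ u)
attachAdj G u (suc i) zero    = does (i ≟ u)
attachAdj G u (suc i) (suc j) = adj G i j

attachLeaf : ∀ {n} → Graph n → Fin n → Graph (suc n)
attachLeaf G u = record
  { adj    = attachAdj G u
  ; sym    = s
  ; irrefl = r
  }
  where
  open import Relation.Binary.PropositionalEquality using (refl)
  s : ∀ i j → attachAdj G u i j ≡ attachAdj G u j i
  s zero zero = refl
  s zero (suc j) = refl
  s (suc i) zero = refl
  s (suc i) (suc j) = sym G i j
  r : ∀ i → attachAdj G u i i ≡ false
  r zero = refl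
  r (suc i) = irrefl G i

subsets : ∀ n → List (Vec Bool n)
subsets zero    = [] ∷ []
subsets (suc n) = map (true ∷_) (subsets n) ++ map (false ∷_) (subsets n)

isDominating : ∀ {n} → Graph n → Vec Bool n → Bool
isDominating {n} G S =
  all (λ v → lookup S v ∨ any (λ w → lookup S w ∧ adj G w v) (allFin n)) (allFin n)

D1 : ∀ {n} → Graph n → ℕ
D1 {n} G = length (filterᵇ (isDominating G) (subsets n))

{-# OPTIONS --safe #-}
module Submission where

-- Split the dominating sets of G₁ by whether they contain the new leaf v. Those containing v are
-- exactly the sets dominating every vertex of T except possibly u. Among them, the ones avoiding u
-- restrict to dominating sets of T − u. For the ones containing u, every neighbour of u but at most
-- one, b, has a leaf ℓ ≠ u, and is dominated by ℓ or lies in the set itself (ℓ must be dominated); so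
-- removing u and adding b gives a dominating set of T − u, at most two-to-one. Hence they number at
-- most 3 D(T − u), and at least D(T). The sets avoiding v contain u and dominate T, so they number at
-- most D(T), and also at most the sets containing both v and u, i.e. 2 D(T − u).

open import Defs hiding (sym)
open import Data.Nat as ℕ using (ℕ; zero; suc; _+_; _*_; _≤_; z≤n; s≤s)
open import Data.Nat.Properties using (≤-trans; ≤-reflexive; m≤n⇒m≤1+n; +-mono-≤; m≤m+n; +-comm; +-identityʳ; *-distribʳ-+; +-commutativeSemigroup; module ≤-Reasoning)
open import Algebra.Properties.CommutativeSemigroup +-commutativeSemigroup using (interchange)
open import Data.Bool as Bool using (Bool; true; false; T; _∧_; _∨_)
open import Data.Bool.ListAction using (any)
open import Data.Bool.Properties using (T-≡; T-∧; T-∨)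
open import Data.Fin using (Fin; zero; suc; punchIn; punchOut; _≟_)
open import Data.Fin.Properties using (punchInᵢ≢i; punchIn-punchOut; punchIn-injective; any?)
open import Data.Vec using (Vec; []; _∷_; lookup; insertAt; _[_]≔_)
open import Data.Vec.Properties using (insertAt-lookup; insertAt-punchIn; lookup∘update; lookup∘update′)
open import Data.List using ([]; _∷_; map; _++_; allFin; length; filterᵇ)
open import Data.List.Properties using (filter-++; filter-none; length-++)
open import Data.List.Membership.Propositional using (_∈_; lose)
open import Data.List.Membership.Propositional.Properties using (∈-allFin; ∈-filter⁺; ∈-length)
open import Data.List.Relation.Unary.Any using (here; there; satisfied)
open import Data.List.Relation.Unary.All as All using (universal)
open import Data.List.Relation.Unary.All.Properties using (all⁺; all⁻)
open import Data.List.Relation.Unary.Any.Properties using (any⁺; any⁻)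
open import Data.Product using (_×_; _,_; ∃; proj₁; proj₂)
open import Data.Sum using (_⊎_; inj₁; inj₂)
open import Function using (_∘_; _⇔_; mk⇔; Equivalence)
open import Relation.Binary.PropositionalEquality using (_≡_; _≢_; refl; sym; trans; cong; cong₂; subst; module ≡-Reasoning)
open import Relation.Nullary using (¬_; Dec; yes; no; contradiction)
open import Relation.Nullary.Decidable using (T?; _×-dec_; ¬?; dec-true; decidable-stable)

open Equivalence using (to; from)

private
  variable
    A B : Set
    n m : ℕ

length-filterᵇ-mono : (p q : A → Bool) → (∀ x → p x ≡ true → q x ≡ true) →
                      ∀ xs → length (filterᵇ p xs) ≤ length (filterᵇ q xs)
length-filterᵇ-mono p q p⇒q []       = z≤n
length-filterᵇ-mono p q p⇒q (x ∷ xs) with p x in px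
... | true  rewrite p⇒q x px = s≤s (length-filterᵇ-mono p q p⇒q xs)
... | false with q x
...   | true  = m≤n⇒m≤1+n (length-filterᵇ-mono p q p⇒q xs)
...   | false = length-filterᵇ-mono p q p⇒q xs

length-filterᵇ-map : (p : B → Bool) (f : A → B) →
                     ∀ xs → length (filterᵇ p (map f xs)) ≡ length (filterᵇ (p ∘ f) xs)
length-filterᵇ-map p f []       = refl
length-filterᵇ-map p f (x ∷ xs) with p (f x)
... | true  = cong suc (length-filterᵇ-map p f xs)
... | false = length-filterᵇ-map p f xs

count : (Vec Bool n → Bool) → ℕ
count {n} p = length (filterᵇ p (subsets n))

count-mono : (p q : Vec Bool n → Bool) → (∀ S → p S ≡ true → q S ≡ true) → count p ≤ count q
count-mono {n} p q p⇒q = length-filterᵇ-mono p q p⇒q (subsets n)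

count-none : (p : Vec Bool n → Bool) → (∀ S → ¬ p S ≡ true) → count p ≡ 0
count-none {n} p ¬p = cong length (filter-none (T? ∘ p) (universal (λ S → ¬p S ∘ to T-≡) (subsets n)))

count-head : (p : Vec Bool (suc n) → Bool) →
             count p ≡ count (p ∘ (true ∷_)) + count (p ∘ (false ∷_))
count-head {n} p = begin
  count p
    ≡⟨ cong length (filter-++ (T? ∘ p) (map (true ∷_) (subsets n)) (map (false ∷_) (subsets n))) ⟩
  length (filterᵇ p (map (true ∷_) (subsets n)) ++ filterᵇ p (map (false ∷_) (subsets n)))
    ≡⟨ length-++ (filterᵇ p (map (true ∷_) (subsets n))) ⟩
  length (filterᵇ p (map (true ∷_) (subsets n))) + length (filterᵇ p (map (false ∷_) (subsets n)))
    ≡⟨ cong₂ _+_ (length-filterᵇ-map p (true ∷_) (subsets n)) (length-filterᵇ-map p (false ∷_) (subsets n)) ⟩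
  count (p ∘ (true ∷_)) + count (p ∘ (false ∷_)) ∎
  where open ≡-Reasoning

count-insertAt : (i : Fin (suc n)) (p : Vec Bool (suc n) → Bool) →
                 count p ≡ count (λ R → p (insertAt R i true)) + count (λ R → p (insertAt R i false))
count-insertAt zero p = count-head p
count-insertAt {suc n} (suc i) p = begin
  count p
    ≡⟨ count-head p ⟩
  count (p ∘ (true ∷_)) + count (p ∘ (false ∷_))
    ≡⟨ cong₂ _+_ (count-insertAt i (p ∘ (true ∷_))) (count-insertAt i (p ∘ (false ∷_))) ⟩
  (c₁₁ + c₁₀) + (c₀₁ + c₀₀)
    ≡⟨ interchange c₁₁ c₁₀ c₀₁ c₀₀ ⟩
  (c₁₁ + c₀₁) + (c₁₀ + c₀₀)
    ≡⟨ sym (cong₂ _+_ (count-head (λ R → p (insertAt R (suc i) true)))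
                      (count-head (λ R → p (insertAt R (suc i) false)))) ⟩
  count (λ R → p (insertAt R (suc i) true)) + count (λ R → p (insertAt R (suc i) false)) ∎
  where
  open ≡-Reasoning
  c₁₁ = count (λ R → p (true ∷ insertAt R i true))
  c₁₀ = count (λ R → p (true ∷ insertAt R i false))
  c₀₁ = count (λ R → p (false ∷ insertAt R i true))
  c₀₀ = count (λ R → p (false ∷ insertAt R i false))

insertAt-[]≔ : ∀ (R : Vec A n) i (x y : A) → insertAt R i x [ i ]≔ y ≡ insertAt R i y
insertAt-[]≔ R       zero    x y = refl
insertAt-[]≔ (r ∷ R) (suc i) x y = cong (r ∷_) (insertAt-[]≔ R i x y)

-- Adding a fixed element b to a set is at most two-to-one.
count-[]≔true : (b : Fin n) (q : Vec Bool n → Bool) → count (λ R → q (R [ b ]≔ true)) ≤ 2 * count q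
count-[]≔true {suc n} b q = begin
  count (λ R → q (R [ b ]≔ true))
    ≡⟨ count-insertAt b (λ R → q (R [ b ]≔ true)) ⟩
  count (λ R → q (insertAt R b true [ b ]≔ true)) + count (λ R → q (insertAt R b false [ b ]≔ true))
    ≤⟨ +-mono-≤ (forget true) (forget false) ⟩
  c₁ + c₁
    ≤⟨ +-mono-≤ (m≤m+n c₁ c₀) (m≤m+n c₁ c₀) ⟩
  (c₁ + c₀) + (c₁ + c₀)
    ≡⟨ cong ((c₁ + c₀) +_) (sym (+-identityʳ (c₁ + c₀))) ⟩
  2 * (c₁ + c₀)
    ≡⟨ cong (2 *_) (sym (count-insertAt b q)) ⟩
  2 * count q ∎
  where
  open ≤-Reasoning
  c₁ = count (λ R → q (insertAt R b true))
  c₀ = count (λ R → q (insertAt R b false))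
  forget : ∀ x → count (λ R → q (insertAt R b x [ b ]≔ true)) ≤ c₁
  forget x = count-mono _ _ (λ R → subst (λ S → q S ≡ true) (insertAt-[]≔ R b x true))

Dominated : Graph n → Vec Bool n → Fin n → Set
Dominated {n} G S v = lookup S v ≡ true ⊎ ∃ λ w → lookup S w ≡ true × Adj G w v

Dominates : Graph n → Vec Bool n → Set
Dominates G S = ∀ v → Dominated G S v

DominatesAllBut : Graph n → Vec Bool n → Fin n → Set
DominatesAllBut G S u = ∀ v → v ≢ u → Dominated G S v

isDominating⇔Dominates : (G : Graph n) (S : Vec Bool n) → isDominating G S ≡ true ⇔ Dominates G S
isDominating⇔Dominates {n} G S = mk⇔ sound complete
  where
  sound : isDominating G S ≡ true → Dominates G S
  sound dom v with to T-∨ (All.lookup (all⁺ _ (allFin n) (from T-≡ dom)) (∈-allFin v))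
  ... | inj₁ v∈S = inj₁ (to T-≡ v∈S)
  ... | inj₂ some with satisfied (any⁻ _ (allFin n) some)
  ...   | w , w∈S∧w~v with to T-∧ w∈S∧w~v
  ...     | w∈S , w~v = inj₂ (w , to T-≡ w∈S , to T-≡ w~v)
  complete : Dominates G S → isDominating G S ≡ true
  complete dom = to T-≡ (all⁻ _ (universal (dominated ∘ dom) (allFin n)))
    where
    dominated : ∀ {v} → Dominated G S v → T (lookup S v ∨ any (λ w → lookup S w ∧ adj G w v) (allFin n))
    dominated (inj₁ v∈S) = from T-∨ (inj₁ (from T-≡ v∈S))
    dominated (inj₂ (w , w∈S , w~v)) =
      from T-∨ (inj₂ (any⁺ _ (lose (∈-allFin w) (from T-∧ (from T-≡ w∈S , from T-≡ w~v)))))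

lookup-[]≔true : ∀ (S : Vec Bool n) b {k} → lookup S k ≡ true → lookup (S [ b ]≔ true) k ≡ true
lookup-[]≔true S b {k} k∈S with k ≟ b
... | yes refl = lookup∘update k S true
... | no  k≢b  = trans (lookup∘update′ k≢b S true) k∈S

dominated-[]≔true : (G : Graph n) (S : Vec Bool n) (b : Fin n) {v : Fin n} →
                    Dominated G S v → Dominated G (S [ b ]≔ true) v
dominated-[]≔true G S b (inj₁ v∈S)             = inj₁ (lookup-[]≔true S b v∈S)
dominated-[]≔true G S b (inj₂ (w , w∈S , w~v)) = inj₂ (w , lookup-[]≔true S b w∈S , w~v)

distinct-members⇒2≤length : ∀ {x y : A} {xs} → x ∈ xs → y ∈ xs → x ≢ y → 2 ≤ length xs
distinct-members⇒2≤length (here refl)  (here refl)  x≢y = contradiction refl x≢y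
distinct-members⇒2≤length (here _)     (there y∈xs) _   = s≤s (∈-length y∈xs)
distinct-members⇒2≤length (there x∈xs) (here _)     _   = s≤s (∈-length x∈xs)
distinct-members⇒2≤length (there x∈xs) (there y∈xs) x≢y = m≤n⇒m≤1+n (distinct-members⇒2≤length x∈xs y∈xs x≢y)

leaf-neighbour-unique : (G : Graph n) {ℓ x y : Fin n} → IsLeaf G ℓ → Adj G ℓ x → Adj G ℓ y → x ≡ y
leaf-neighbour-unique {n} G {ℓ} {x} {y} leaf ℓ~x ℓ~y with x ≟ y
... | yes x≡y = x≡y
... | no  x≢y = contradiction (subst (2 ≤_) leaf two-neighbours) λ { (s≤s ()) }
  where
  neighbour : ∀ {z} → Adj G ℓ z → z ∈ filterᵇ (adj G ℓ) (allFin n)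
  neighbour {z} ℓ~z = ∈-filter⁺ (T? ∘ adj G ℓ) (∈-allFin z) (from T-≡ ℓ~z)
  two-neighbours : 2 ≤ degree G ℓ
  two-neighbours = distinct-members⇒2≤length (neighbour ℓ~x) (neighbour ℓ~y) x≢y

module _ (G : Graph n) (u : Fin n) where

  attachLeaf-leaf-adj : ∀ {v} → Adj (attachLeaf G u) zero (suc v) → v ≡ u
  attachLeaf-leaf-adj {v} v~leaf with v ≟ u | v~leaf
  ... | yes v≡u | _ = v≡u
  ... | no  _   | ()

  attachLeaf-dominated-suc : ∀ {x S v} → Dominated (attachLeaf G u) (x ∷ S) (suc v) →
                             Dominated G S v ⊎ (x ≡ true × v ≡ u)
  attachLeaf-dominated-suc (inj₁ v∈S)                      = inj₁ (inj₁ v∈S)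
  attachLeaf-dominated-suc (inj₂ (zero  , x≡true , leaf~v)) = inj₂ (x≡true , attachLeaf-leaf-adj leaf~v)
  attachLeaf-dominated-suc (inj₂ (suc w , w∈S , w~v))       = inj₁ (inj₂ (w , w∈S , w~v))

  attachLeaf-withLeaf⇔ : ∀ S → isDominating (attachLeaf G u) (true ∷ S) ≡ true ⇔ DominatesAllBut G S u
  attachLeaf-withLeaf⇔ S = mk⇔ restrict extend
    where
    restrict : isDominating (attachLeaf G u) (true ∷ S) ≡ true → DominatesAllBut G S u
    restrict dom v v≢u with attachLeaf-dominated-suc (to (isDominating⇔Dominates (attachLeaf G u) (true ∷ S)) dom (suc v))
    ... | inj₁ dominated = dominated
    ... | inj₂ (_ , v≡u) = contradiction v≡u v≢u
    extend : DominatesAllBut G S u → isDominating (attachLeaf G u) (true ∷ S) ≡ true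
    extend dom = from (isDominating⇔Dominates (attachLeaf G u) (true ∷ S)) dominated
      where
      dominated : Dominates (attachLeaf G u) (true ∷ S)
      dominated zero = inj₁ refl
      dominated (suc v) with v ≟ u
      ... | yes refl = inj₂ (zero , refl , dec-true (u ≟ u) refl)
      ... | no  v≢u with dom v v≢u
      ...   | inj₁ v∈S             = inj₁ v∈S
      ...   | inj₂ (w , w∈S , w~v) = inj₂ (suc w , w∈S , w~v)

  attachLeaf-withoutLeaf : ∀ S → isDominating (attachLeaf G u) (false ∷ S) ≡ true →
                           lookup S u ≡ true × Dominates G S
  attachLeaf-withoutLeaf S dom = u∈S (dominated zero) , restrict
    where
    dominated : Dominates (attachLeaf G u) (false ∷ S)
    dominated = to (isDominating⇔Dominates (attachLeaf G u) (false ∷ S)) dom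
    u∈S : Dominated (attachLeaf G u) (false ∷ S) zero → lookup S u ≡ true
    u∈S (inj₁ ())
    u∈S (inj₂ (zero  , () , _))
    u∈S (inj₂ (suc w , w∈S , w~leaf)) = subst (λ w → lookup S w ≡ true) (attachLeaf-leaf-adj w~leaf) w∈S
    restrict : Dominates G S
    restrict v with attachLeaf-dominated-suc (dominated (suc v))
    ... | inj₁ d        = d
    ... | inj₂ (() , _)

punchIn-onto : ∀ {u w : Fin (suc n)} → u ≢ w → ∃ λ k → punchIn u k ≡ w
punchIn-onto u≢w = punchOut u≢w , punchIn-punchOut u≢w

HasLeafBesides : Graph n → Fin n → Fin n → Set
HasLeafBesides G u w = ∃ λ ℓ → Adj G w ℓ × IsLeaf G ℓ × ℓ ≢ u

AtMostOneUnsupportedNeighbour : Graph n → Fin n → Set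
AtMostOneUnsupportedNeighbour G u =
  ∀ a b → Adj G u a → Adj G u b → ¬ IsSupport G a → ¬ IsSupport G b → a ≡ b

module _ (G : Graph n) where

  adj? : ∀ a b → Dec (Adj G a b)
  adj? a b = adj G a b Bool.≟ true

  isLeaf? : ∀ ℓ → Dec (IsLeaf G ℓ)
  isLeaf? ℓ = degree G ℓ ℕ.≟ 1

  hasLeafBesides? : ∀ u w → Dec (HasLeafBesides G u w)
  hasLeafBesides? u w = any? (λ ℓ → adj? w ℓ ×-dec isLeaf? ℓ ×-dec ¬? (ℓ ≟ u))

  support-without-leafBesides⇒leaf : ∀ {u w} → IsSupport G w → ¬ HasLeafBesides G u w → IsLeaf G u
  support-without-leafBesides⇒leaf {u} (ℓ , w~ℓ , leaf) ¬leafBesides with ℓ ≟ u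
  ... | yes refl = leaf
  ... | no  ℓ≢u  = contradiction (ℓ , w~ℓ , leaf , ℓ≢u) ¬leafBesides

  -- A neighbour that is a support vertex only through u forces u to be a leaf, with no other neighbour.
  leaflessNeighbour-unique : ∀ {u x y} → AtMostOneUnsupportedNeighbour G u →
                             Adj G u x → Adj G u y → ¬ HasLeafBesides G u x → ¬ HasLeafBesides G u y → x ≡ y
  leaflessNeighbour-unique {u} {x} {y} atMostOne u~x u~y ¬x ¬y with x ≟ y
  ... | yes x≡y = x≡y
  ... | no  x≢y = atMostOne x y u~x u~y (unsupported ¬x) (unsupported ¬y)
    where
    unsupported : ∀ {z} → ¬ HasLeafBesides G u z → ¬ IsSupport G z
    unsupported ¬z support = x≢y (leaf-neighbour-unique G (support-without-leafBesides⇒leaf support ¬z) u~x u~y)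

module _ (G : Graph (suc m)) (u : Fin (suc m)) where

  SupportedNeighboursBut : Fin m → Set
  SupportedNeighboursBut b = ∀ j → Adj G u (punchIn u j) → j ≢ b → HasLeafBesides G u (punchIn u j)

  dominated-deleteVertex : ∀ R x j → Dominated G (insertAt R u x) (punchIn u j) →
                           Dominated (deleteVertex G u) R j ⊎ (x ≡ true × Adj G u (punchIn u j))
  dominated-deleteVertex R x j (inj₁ j∈S) = inj₁ (inj₁ (trans (sym (insertAt-punchIn R u x j)) j∈S))
  dominated-deleteVertex R x j (inj₂ (w , w∈S , w~j)) with u ≟ w
  ... | yes refl = inj₂ (trans (sym (insertAt-lookup R u x)) w∈S , w~j)
  ... | no  u≢w with punchIn-onto u≢w
  ...   | k , refl = inj₁ (inj₂ (k , trans (sym (insertAt-punchIn R u x k)) w∈S , w~j))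

  dominatesAllBut-insertAt-false : ∀ R → DominatesAllBut G (insertAt R u false) u → Dominates (deleteVertex G u) R
  dominatesAllBut-insertAt-false R dom j with dominated-deleteVertex R false j (dom (punchIn u j) (punchInᵢ≢i u j))
  ... | inj₁ dominated = dominated
  ... | inj₂ (() , _)

  -- The leaf ℓ is dominated without u: either ℓ is in the set, or its only neighbour is.
  dominated-by-leafBesides : ∀ R x j → DominatesAllBut G (insertAt R u x) u →
                             HasLeafBesides G u (punchIn u j) → Dominated (deleteVertex G u) R j
  dominated-by-leafBesides R x j dom (ℓ , j~ℓ , leaf , ℓ≢u) with dom ℓ ℓ≢u
  ... | inj₁ ℓ∈S with punchIn-onto (ℓ≢u ∘ sym)
  ...   | k , refl = inj₂ (k , trans (sym (insertAt-punchIn R u x k)) ℓ∈S , trans (Graph.sym G _ _) j~ℓ)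
  dominated-by-leafBesides R x j dom (ℓ , j~ℓ , leaf , ℓ≢u) | inj₂ (w , w∈S , w~ℓ)
    with leaf-neighbour-unique G leaf (trans (Graph.sym G ℓ w) w~ℓ) (trans (Graph.sym G ℓ _) j~ℓ)
  ... | refl = inj₁ (trans (sym (insertAt-punchIn R u x j)) w∈S)

  dominatesAllBut-insertAt-true : ∀ {b} → SupportedNeighboursBut b → ∀ R →
                                  DominatesAllBut G (insertAt R u true) u → Dominates (deleteVertex G u) (R [ b ]≔ true)
  dominatesAllBut-insertAt-true {b} supported R dom j with j ≟ b
  ... | yes refl = inj₁ (lookup∘update j R true)
  ... | no  j≢b  = dominated-[]≔true (deleteVertex G u) R b dominated-without-b
    where
    dominated-without-b : Dominated (deleteVertex G u) R j
    dominated-without-b with dominated-deleteVertex R true j (dom (punchIn u j) (punchInᵢ≢i u j))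
    ... | inj₁ dominated  = dominated
    ... | inj₂ (_ , u~j) = dominated-by-leafBesides R true j dom (supported j u~j j≢b)

  supportedNeighboursBut-exists : AtMostOneUnsupportedNeighbour G u → Fin m → ∃ SupportedNeighboursBut
  supportedNeighboursBut-exists atMostOne j₀
    with any? (λ j → adj? G u (punchIn u j) ×-dec ¬? (hasLeafBesides? G u (punchIn u j)))
  ... | yes (b , u~b , ¬b) = b , λ j u~j j≢b → decidable-stable (hasLeafBesides? G u (punchIn u j))
          (λ ¬j → j≢b (punchIn-injective u j b (leaflessNeighbour-unique G atMostOne u~j u~b ¬j ¬b)))
  ... | no  none = j₀ , λ j u~j _ → decidable-stable (hasLeafBesides? G u (punchIn u j))
          (λ ¬j → none (j , u~j , ¬j))

  dominatingWithLeaf dominatingWithoutLeaf : Vec Bool (suc m) → Bool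
  dominatingWithLeaf    S = isDominating (attachLeaf G u) (true ∷ S)
  dominatingWithoutLeaf S = isDominating (attachLeaf G u) (false ∷ S)

  D1-attachLeaf-split : D1 (attachLeaf G u) ≡ count dominatingWithLeaf + count dominatingWithoutLeaf
  D1-attachLeaf-split = count-head (isDominating (attachLeaf G u))

  dominates⇒dominatingWithLeaf : ∀ S → Dominates G S → dominatingWithLeaf S ≡ true
  dominates⇒dominatingWithLeaf S dom = from (attachLeaf-withLeaf⇔ G u S) (λ v _ → dom v)

  D1≤count-withLeaf : D1 G ≤ count dominatingWithLeaf
  D1≤count-withLeaf = count-mono _ _ λ S dom →
    dominates⇒dominatingWithLeaf S (to (isDominating⇔Dominates G S) dom)

  count-withoutLeaf≤D1 : count dominatingWithoutLeaf ≤ D1 G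
  count-withoutLeaf≤D1 = count-mono _ _ λ S dom →
    from (isDominating⇔Dominates G S) (proj₂ (attachLeaf-withoutLeaf G u S dom))

  module _ {b : Fin m} (supported : SupportedNeighboursBut b) where

    count-withLeaf-insertAt-true≤ : count (λ R → dominatingWithLeaf (insertAt R u true)) ≤ 2 * D1 (deleteVertex G u)
    count-withLeaf-insertAt-true≤ = ≤-trans
      (count-mono _ (λ R → isDominating (deleteVertex G u) (R [ b ]≔ true)) λ R dom →
        from (isDominating⇔Dominates (deleteVertex G u) (R [ b ]≔ true))
             (dominatesAllBut-insertAt-true supported R (to (attachLeaf-withLeaf⇔ G u (insertAt R u true)) dom)))
      (count-[]≔true b (isDominating (deleteVertex G u)))

    count-withLeaf≤ : count dominatingWithLeaf ≤ 3 * D1 (deleteVertex G u)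
    count-withLeaf≤ = begin
      count dominatingWithLeaf
        ≡⟨ count-insertAt u dominatingWithLeaf ⟩
      count (λ R → dominatingWithLeaf (insertAt R u true)) + count (λ R → dominatingWithLeaf (insertAt R u false))
        ≤⟨ +-mono-≤ count-withLeaf-insertAt-true≤ (count-mono _ _ without-u) ⟩
      2 * D1 (deleteVertex G u) + D1 (deleteVertex G u)
        ≡⟨ +-comm (2 * D1 (deleteVertex G u)) (D1 (deleteVertex G u)) ⟩
      3 * D1 (deleteVertex G u) ∎
      where
      open ≤-Reasoning
      without-u : ∀ R → dominatingWithLeaf (insertAt R u false) ≡ true → isDominating (deleteVertex G u) R ≡ true
      without-u R dom = from (isDominating⇔Dominates (deleteVertex G u) R)
        (dominatesAllBut-insertAt-false R (to (attachLeaf-withLeaf⇔ G u (insertAt R u false)) dom))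

    count-withoutLeaf≤ : count dominatingWithoutLeaf ≤ 2 * D1 (deleteVertex G u)
    count-withoutLeaf≤ = begin
      count dominatingWithoutLeaf
        ≡⟨ count-insertAt u dominatingWithoutLeaf ⟩
      count (λ R → dominatingWithoutLeaf (insertAt R u true)) + count (λ R → dominatingWithoutLeaf (insertAt R u false))
        ≡⟨ cong (count (λ R → dominatingWithoutLeaf (insertAt R u true)) +_) (count-none _ u∉R) ⟩
      count (λ R → dominatingWithoutLeaf (insertAt R u true)) + 0
        ≡⟨ +-identityʳ _ ⟩
      count (λ R → dominatingWithoutLeaf (insertAt R u true))
        ≤⟨ count-mono _ _ (λ R → withoutLeaf⇒withLeaf (insertAt R u true)) ⟩
      count (λ R → dominatingWithLeaf (insertAt R u true))
        ≤⟨ count-withLeaf-insertAt-true≤ ⟩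
      2 * D1 (deleteVertex G u) ∎
      where
      open ≤-Reasoning
      withoutLeaf⇒withLeaf : ∀ S → dominatingWithoutLeaf S ≡ true → dominatingWithLeaf S ≡ true
      withoutLeaf⇒withLeaf S dom = dominates⇒dominatingWithLeaf S (proj₂ (attachLeaf-withoutLeaf G u S dom))
      u∉R : ∀ R → ¬ dominatingWithoutLeaf (insertAt R u false) ≡ true
      u∉R R dom with trans (sym (insertAt-lookup R u false)) (proj₁ (attachLeaf-withoutLeaf G u (insertAt R u false) dom))
      ... | ()

lemma3p3 : (m : ℕ) (T : Graph (suc m)) (u : Fin (suc m)) →
    IsTree T → 3 ≤ suc m →
    ¬ IsSupport T u →
    (∀ a b → Adj T u a → Adj T u b → ¬ IsSupport T a → ¬ IsSupport T b → a ≡ b) →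
    (D1 (attachLeaf T u) ≤ D1 T + 3 * D1 (deleteVertex T u))
      × (D1 (attachLeaf T u) ≤ 5 * D1 (deleteVertex T u))
      × (D1 T ≤ 3 * D1 (deleteVertex T u))
lemma3p3 zero    T u _ (s≤s ()) _ _
lemma3p3 (suc m) T u _ _ _ atMostOne with supportedNeighboursBut-exists T u atMostOne zero
... | _ , supported =
    ≤-trans split (≤-trans (+-mono-≤ withLeaf≤ (count-withoutLeaf≤D1 T u)) (≤-reflexive (+-comm _ (D1 T))))
  , ≤-trans split (≤-trans (+-mono-≤ withLeaf≤ (count-withoutLeaf≤ T u supported))
                           (≤-reflexive (sym (*-distribʳ-+ (D1 (deleteVertex T u)) 3 2))))
  , ≤-trans (D1≤count-withLeaf T u) withLeaf≤
  where
  split : D1 (attachLeaf T u) ≤ count (dominatingWithLeaf T u) + count (dominatingWithoutLeaf T u)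
  split = ≤-reflexive (D1-attachLeaf-split T u)
  withLeaf≤ : count (dominatingWithLeaf T u) ≤ 3 * D1 (deleteVertex T u)
  withLeaf≤ = count-withLeaf≤ T u supported
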